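{- Let $G=(V,E)$ be a bipartite graph with parts $V_1=\{v_1,\ldots,v_{n_1}\}$ and $V_2=\{v'_1,\ldots,v'_{n_2}\}$, $n_1\le n_2$, $E\subseteq V_1\times V_2$, in which maximum matchings have size $t\le n_1$, and suppose $M:=\{(v_1,v'_1),\ldots,(v_t,v'_t)\}$ is a maximum matching of $G$. Then every allowed edge of type II with respect to $M$ is contained in a left-augmented or a right-augmented alternating path in $G$ with respect to $M$. Conversely, every edge contained in a left-augmented or a right-augmented alternating path with respect to $M$ is allowed.
   Context: A matching is a set of pairwise non-adjacent edges; a maximum matching is one of largest cardinality; an edge is allowed if it belongs to some maximum matching. A node $v_i$ or $v'_i$ is upper if $i\le t$ and lower if $i>t$; an edge $(v_i,v'_j)$ is upper if $i,j\le t$, and lower otherwise. An upper edge is an allowed edge of type I if it is contained in a maximum matching of $G$ consisting only of upper edges; it is an allowed edge of type II if it is allowed but every maximum matching of $G$ containing it also contains a lower edge. A set $P$ of $\ell-1\ge 1$ upper edges is an upper alternating path if there exist $\ell$ distinct indices $1\le i_1,\ldots,i_\ell\le t$ with $P=\{(v_{i_1},v'_{i_2}),(v_{i_2},v'_{i_3}),\ldots,(v_{i_{\ell-1}},v'_{i_\ell})\}\subseteq E$. If moreover $i_0>t$ and $\lambda=(v_{i_0},v'_{i_1})\in E$, then $\{\lambda\}\cup P$ is a left-augmented alternating path; if $i_{\ell+1}>t$ and $\rho=(v_{i_\ell},v'_{i_{\ell+1}})\in E$, then $P\cup\{\rho\}$ is a right-augmented alternating path. -}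

module Defs where

open import Data.Nat using (ℕ; _<_; _≤_)
open import Data.Product using (_×_; _,_; proj₁; proj₂; ∃; ∃-syntax)
open import Data.Sum using (_⊎_)
open import Data.List using (List; []; _∷_; map; length; _++_)
open import Data.List.Membership.Propositional using (_∈_)
open import Data.List.Relation.Unary.All using (All)
open import Data.List.Relation.Unary.Unique.Propositional using (Unique)
open import Relation.Nullary using (¬_)

-- Vertices are 0-indexed: v_i is i with i < n₁, v'_j is j with j < n₂.
-- An edge (v_i , v'_j) is the pair (i , j).
Edge : Set
Edge = ℕ × ℕ

record BipGraph : Set₁ where
  field
    n₁ n₂   : ℕ
    E       : ℕ → ℕ → Set
    E-bound : ∀ {i j} → E i j → i < n₁ × j < n₂

module _ (G : BipGraph) where
  open BipGraph G

  InE : Edge → Set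
  InE e = E (proj₁ e) (proj₂ e)

  IsMatching : List Edge → Set
  IsMatching L = All InE L × Unique (map proj₁ L) × Unique (map proj₂ L)

  IsMaximumMatching : List Edge → Set
  IsMaximumMatching L = IsMatching L × (∀ L' → IsMatching L' → length L' ≤ length L)

  Allowed : Edge → Set
  Allowed e = ∃[ L ] (IsMaximumMatching L × e ∈ L)

  Upper : ℕ → Edge → Set
  Upper t e = proj₁ e < t × proj₂ e < t

  Lower : ℕ → Edge → Set
  Lower t e = ¬ Upper t e

  AllowedTypeII : ℕ → Edge → Set
  AllowedTypeII t e =
    Upper t e × Allowed e ×
    (∀ L → IsMaximumMatching L → e ∈ L → ∃[ f ] (f ∈ L × Lower t f))

  -- edges (v_{i_k}, v'_{i_{k+1}}) of the index sequence i_1 … i_ℓ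
  pathEdges : List ℕ → List Edge
  pathEdges (a ∷ b ∷ r) = (a , b) ∷ pathEdges (b ∷ r)
  pathEdges _ = []

  -- i_1 … i_ℓ, ℓ ≥ 2, distinct indices ≤ t (0-indexed: < t), consecutive edges in E
  UpperAltPath : ℕ → List ℕ → Set
  UpperAltPath t is = 2 ≤ length is × All (_< t) is × Unique is × All InE (pathEdges is)

  InLeftAugPath : ℕ → Edge → Set
  InLeftAugPath t e = ∃[ i₀ ] ∃[ i₁ ] ∃[ rest ]
    (UpperAltPath t (i₁ ∷ rest) × t ≤ i₀ × E i₀ i₁ ×
     e ∈ ((i₀ , i₁) ∷ pathEdges (i₁ ∷ rest)))

  InRightAugPath : ℕ → Edge → Set
  InRightAugPath t e = ∃[ is ] ∃[ iℓ ] ∃[ iℓ₊₁ ]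
    (UpperAltPath t (is ++ iℓ ∷ []) × t ≤ iℓ₊₁ × E iℓ iℓ₊₁ ×
     e ∈ pathEdges (is ++ iℓ ∷ iℓ₊₁ ∷ []))

-- Both directions rest on one construction. Let P be a left- and right-unique set of
-- edges with upper sources in which every upper target is again a source. Then P,
-- together with the diagonal edges (i , i) at the upper vertices i that are not
-- sources of P, is a matching of size t, hence maximum. The edges of an augmented
-- alternating path form such a P, so they are allowed.
--
-- Conversely, let e₀ be of type II and in the maximum matching L, and follow L forwards
-- and backwards from e₀ through upper vertices. The walk cannot close up, since
-- completing the cycle would give a maximum matching of upper edges containing e₀.
-- Nor can it get stuck at upper vertices at both ends, since exchanging L along the
-- walk for diagonal edges would enlarge L. As there are only t upper vertices, the walk
-- leaves the upper part at one end, and that end makes it an augmented alternating path.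

module Submission where

open import Defs
open import Data.Bool using (if_then_else_)
open import Data.Empty using (⊥; ⊥-elim)
open import Data.List using (List; []; _∷_; [_]; _∷ʳ_; length; map; upTo)
open import Data.List.Membership.Propositional using (_∈_; _∉_; find; lose)
open import Data.List.Membership.Propositional.Properties
  using (∈-map⁺; ∈-map⁻; ∈-++⁺ˡ; ∈-++⁺ʳ; ∈-++⁻; ∈-upTo⁺; ∈-upTo⁻)
open import Data.List.Properties using (length-map; length-upTo; length-++; map-∘; ++-assoc)
open import Data.List.Relation.Binary.Subset.Propositional using (_⊆_)
open import Data.List.Relation.Unary.All as All using (All; []; _∷_)
import Data.List.Relation.Unary.All.Properties as AllP
open import Data.List.Relation.Unary.AllPairs using ([]; _∷_)
open import Data.List.Relation.Unary.Any using (here; there; any?)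
open import Data.List.Relation.Unary.Unique.Propositional using (Unique)
import Data.List.Relation.Unary.Unique.Propositional.Properties as Unique
open import Data.Nat using (ℕ; zero; suc; _+_; _<_; _≤_; _≟_; _<?_; s≤s; z≤n)
open import Data.Nat.Properties using (≤⇒≯; ≮⇒≥; 1+n≰n; +-suc; +-comm; +-identityʳ; m≤n+m)
open import Data.List.Membership.DecPropositional _≟_ using (_∈?_)
open import Data.Product using (_×_; _,_; proj₁; proj₂; ∃-syntax; swap)
open import Data.Sum using (_⊎_; inj₁; inj₂; [_,_]′)
open import Relation.Nullary using (yes; no; does)
open import Function using (_∘′_)
open import Relation.Binary.PropositionalEquality using (_≡_; refl; sym; trans; cong; subst)

InjectiveOn : {A B : Set} → (A → B) → List A → Set
InjectiveOn f xs = ∀ {x y} → x ∈ xs → y ∈ xs → f x ≡ f y → x ≡ y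

module _ {A B : Set} (f : A → B) where

  Unique-map⇒injectiveOn : ∀ {xs} → Unique (map f xs) → InjectiveOn f xs
  Unique-map⇒injectiveOn (_   ∷ _) (here refl) (here refl) _  = refl
  Unique-map⇒injectiveOn (fx∉ ∷ _) (here refl) (there y∈) eq =
    ⊥-elim (All.lookup fx∉ (∈-map⁺ f y∈) eq)
  Unique-map⇒injectiveOn (fy∉ ∷ _) (there x∈) (here refl) eq =
    ⊥-elim (All.lookup fy∉ (∈-map⁺ f x∈) (sym eq))
  Unique-map⇒injectiveOn (_   ∷ u) (there x∈) (there y∈) eq = Unique-map⇒injectiveOn u x∈ y∈ eq

  Unique-map⁺-injectiveOn : ∀ {xs} → Unique xs → InjectiveOn f xs → Unique (map f xs)
  Unique-map⁺-injectiveOn [] _ = []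
  Unique-map⁺-injectiveOn {x ∷ xs} (x∉ ∷ u) inj =
    All.tabulate fresh ∷ Unique-map⁺-injectiveOn u (λ x∈ y∈ → inj (there x∈) (there y∈))
    where
    fresh : ∀ {w} → w ∈ map f xs → f x ≡ w → ⊥
    fresh w∈ eq with ∈-map⁻ f w∈
    ... | y , y∈ , refl = All.lookup x∉ y∈ (inj (here refl) (there y∈) eq)

Unique-∷ʳ⁺ : {A : Set} {xs : List A} {x : A} → Unique xs → x ∉ xs → Unique (xs ∷ʳ x)
Unique-∷ʳ⁺ u x∉ = Unique.++⁺ u ([] ∷ []) λ { (x∈ , here refl) → x∉ x∈ }

length-∷ʳ : {A : Set} (xs : List A) (x : A) → length (xs ∷ʳ x) ≡ suc (length xs)
length-∷ʳ xs x = trans (length-++ xs) (+-comm (length xs) 1)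

RightUnique : List Edge → Set
RightUnique P = ∀ {p q q'} → (p , q) ∈ P → (p , q') ∈ P → q ≡ q'

LeftUnique : List Edge → Set
LeftUnique P = ∀ {p p' q} → (p , q) ∈ P → (p' , q) ∈ P → p ≡ p'

outEdge? : ∀ (P : List Edge) i → (∃[ j ] (i , j) ∈ P) ⊎ (∀ j → (i , j) ∉ P)
outEdge? P i with any? (λ e → proj₁ e ≟ i) P
... | yes found with find found
...   | (_ , j) , ij∈P , refl = inj₁ (j , ij∈P)
outEdge? P i | no none = inj₂ λ j ij∈P → none (lose ij∈P refl)

inEdge? : ∀ (P : List Edge) j → (∃[ i ] (i , j) ∈ P) ⊎ (∀ i → (i , j) ∉ P)
inEdge? P j with any? (λ e → proj₂ e ≟ j) P
... | yes found with find found
...   | (i , _) , ij∈P , refl = inj₁ (i , ij∈P)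
inEdge? P j | no none = inj₂ λ i ij∈P → none (lose ij∈P refl)

follow : List Edge → ℕ → ℕ
follow P i = [ proj₁ , (λ _ → i) ]′ (outEdge? P i)

follow-edge-or-fixed : ∀ P i → (i , follow P i) ∈ P ⊎ follow P i ≡ i
follow-edge-or-fixed P i with outEdge? P i
... | inj₁ (_ , ij∈P) = inj₁ ij∈P
... | inj₂ _ = inj₂ refl

follow-edge : ∀ {P} → RightUnique P → ∀ {p q} → (p , q) ∈ P → follow P p ≡ q
follow-edge {P} ru {p} pq∈P with outEdge? P p
... | inj₁ (_ , pj∈P) = ru pj∈P pq∈P
... | inj₂ none = ⊥-elim (none _ pq∈P)

graph : (ℕ → ℕ) → List ℕ → List Edge
graph k = map (λ i → i , k i)

flipG : BipGraph → BipGraph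
flipG G = record { n₁ = n₂ ; n₂ = n₁ ; E = λ i j → E j i ; E-bound = λ e → swap (E-bound e) }
  where open BipGraph G

module _ (G : BipGraph) where
  open BipGraph G

  pathEdges-source : ∀ zs {p q} → (p , q) ∈ pathEdges G zs → p ∈ zs
  pathEdges-source (a ∷ b ∷ r) (here refl) = here refl
  pathEdges-source (a ∷ b ∷ r) (there m) = there (pathEdges-source (b ∷ r) m)

  pathEdges-target∈tail : ∀ w zs {p q} → (p , q) ∈ pathEdges G (w ∷ zs) → q ∈ zs
  pathEdges-target∈tail w (b ∷ r) (here refl) = here refl
  pathEdges-target∈tail w (b ∷ r) (there m) = there (pathEdges-target∈tail b r m)

  pathEdges-target : ∀ zs {p q} → (p , q) ∈ pathEdges G zs → q ∈ zs
  pathEdges-target (w ∷ zs) m = there (pathEdges-target∈tail w zs m)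

  pathEdges-source∈init : ∀ ys z {p q} → (p , q) ∈ pathEdges G (ys ∷ʳ z) → p ∈ ys
  pathEdges-source∈init (a ∷ []) z (here refl) = here refl
  pathEdges-source∈init (a ∷ b ∷ r) z (here refl) = here refl
  pathEdges-source∈init (a ∷ b ∷ r) z (there m) = there (pathEdges-source∈init (b ∷ r) z m)

  pathEdges-predecessor : ∀ w zs {y} → y ∈ zs → ∃[ x ] (x , y) ∈ pathEdges G (w ∷ zs)
  pathEdges-predecessor w (b ∷ r) (here refl) = w , here refl
  pathEdges-predecessor w (b ∷ r) (there y∈) with pathEdges-predecessor b r y∈
  ... | x , xy∈ = x , there xy∈

  pathEdges-successor : ∀ ys z {y} → y ∈ ys → ∃[ y' ] (y , y') ∈ pathEdges G (ys ∷ʳ z)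
  pathEdges-successor (a ∷ []) z (here refl) = z , here refl
  pathEdges-successor (a ∷ b ∷ r) z (here refl) = b , here refl
  pathEdges-successor (a ∷ b ∷ r) z (there y∈) with pathEdges-successor (b ∷ r) z y∈
  ... | y' , yy'∈ = y' , there yy'∈

  pathEdges-∷ʳ : ∀ ys x y → pathEdges G (ys ∷ʳ x ∷ʳ y) ≡ pathEdges G (ys ∷ʳ x) ∷ʳ (x , y)
  pathEdges-∷ʳ [] x y = refl
  pathEdges-∷ʳ (a ∷ []) x y = refl
  pathEdges-∷ʳ (a ∷ b ∷ r) x y = cong ((a , b) ∷_) (pathEdges-∷ʳ (b ∷ r) x y)

  pathEdges-∷ʳ⁺ : ∀ ys x y → pathEdges G (ys ∷ʳ x) ⊆ pathEdges G (ys ∷ʳ x ∷ʳ y)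
  pathEdges-∷ʳ⁺ ys x y e∈ = subst (_ ∈_) (sym (pathEdges-∷ʳ ys x y)) (∈-++⁺ˡ e∈)

  All-pathEdges-∷ʳ : ∀ {Q : Edge → Set} ys x y →
    All Q (pathEdges G (ys ∷ʳ x)) → Q (x , y) → All Q (pathEdges G (ys ∷ʳ x ∷ʳ y))
  All-pathEdges-∷ʳ {Q} ys x y qs q = subst (All Q) (sym (pathEdges-∷ʳ ys x y)) (AllP.∷ʳ⁺ qs q)

  pathEdges-rightUnique : ∀ zs → Unique zs → RightUnique (pathEdges G zs)
  pathEdges-rightUnique (a ∷ b ∷ r) _ (here refl) (here refl) = refl
  pathEdges-rightUnique (a ∷ b ∷ r) (a∉ ∷ _) (here refl) (there m) =
    ⊥-elim (All.lookup a∉ (pathEdges-source (b ∷ r) m) refl)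
  pathEdges-rightUnique (a ∷ b ∷ r) (a∉ ∷ _) (there m) (here refl) =
    ⊥-elim (All.lookup a∉ (pathEdges-source (b ∷ r) m) refl)
  pathEdges-rightUnique (a ∷ b ∷ r) (_ ∷ u) (there m) (there m') = pathEdges-rightUnique (b ∷ r) u m m'

  pathEdges-leftUnique : ∀ zs → Unique zs → LeftUnique (pathEdges G zs)
  pathEdges-leftUnique (a ∷ b ∷ r) _ (here refl) (here refl) = refl
  pathEdges-leftUnique (a ∷ b ∷ r) (_ ∷ b∉ ∷ _) (here refl) (there m) =
    ⊥-elim (All.lookup b∉ (pathEdges-target∈tail b r m) refl)
  pathEdges-leftUnique (a ∷ b ∷ r) (_ ∷ b∉ ∷ _) (there m) (here refl) =
    ⊥-elim (All.lookup b∉ (pathEdges-target∈tail b r m) refl)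
  pathEdges-leftUnique (a ∷ b ∷ r) (_ ∷ u) (there m) (there m') = pathEdges-leftUnique (b ∷ r) u m m'

  pathEdges-length : ∀ zs {e} → e ∈ pathEdges G zs → 2 ≤ length zs
  pathEdges-length (a ∷ b ∷ r) _ = s≤s (s≤s z≤n)

  pathEdges-upper : ∀ {t} zs → All (_< t) zs → ∀ {e} → e ∈ pathEdges G zs → Upper G t e
  pathEdges-upper zs upper e∈ =
    All.lookup upper (pathEdges-source zs e∈) , All.lookup upper (pathEdges-target zs e∈)

  matching⇒rightUnique : ∀ {L} → IsMatching G L → RightUnique L
  matching⇒rightUnique (_ , u , _) m m' = cong proj₂ (Unique-map⇒injectiveOn proj₁ u m m' refl)

  matching⇒leftUnique : ∀ {L} → IsMatching G L → LeftUnique L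
  matching⇒leftUnique (_ , _ , u) m m' = cong proj₁ (Unique-map⇒injectiveOn proj₂ u m m' refl)

  graph-matching : ∀ k xs → All (λ i → E i (k i)) xs → Unique xs → InjectiveOn k xs →
                   IsMatching G (graph k xs)
  graph-matching k xs edges distinct inj =
      AllP.map⁺ edges
    , subst Unique (map-∘ xs) (Unique.map⁺ (λ eq → eq) distinct)
    , subst Unique (map-∘ xs) (Unique-map⁺-injectiveOn k distinct inj)

  swap-matching : ∀ {N} → IsMatching (flipG G) N → IsMatching G (map swap N)
  swap-matching {N} (edges , u₁ , u₂) =
    AllP.map⁺ edges , subst Unique (map-∘ N) u₂ , subst Unique (map-∘ N) u₁

module Completion (G : BipGraph) (t : ℕ) (diagonal : ∀ i → i < t → BipGraph.E G i i) where
  open BipGraph G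

  record Completable (P : List Edge) : Set where
    field
      edges       : All (InE G) P
      rightUnique : RightUnique P
      leftUnique  : LeftUnique P
      source<t    : ∀ {p q} → (p , q) ∈ P → p < t
      continues   : ∀ {p q} → (p , q) ∈ P → q < t → ∃[ r ] (q , r) ∈ P

  complete : List Edge → List Edge
  complete P = graph (follow P) (upTo t)

  length-complete : ∀ P → length (complete P) ≡ t
  length-complete _ = trans (length-map _ (upTo t)) (length-upTo t)

  ∈-complete⁻ : ∀ P {f} → f ∈ complete P → f ∈ P ⊎ ∃[ i ] (i < t × f ≡ (i , i))
  ∈-complete⁻ P f∈ with ∈-map⁻ _ f∈
  ... | i , i∈ , refl with follow-edge-or-fixed P i
  ...   | inj₁ e∈P  = inj₁ e∈P
  ...   | inj₂ fixed = inj₂ (i , ∈-upTo⁻ i∈ , cong (i ,_) fixed)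

  module _ {P} (c : Completable P) where
    open Completable c

    ∈-complete⁺ : P ⊆ complete P
    ∈-complete⁺ {p , q} pq∈P =
      subst (λ k → (p , k) ∈ complete P) (follow-edge rightUnique pq∈P)
            (∈-map⁺ _ (∈-upTo⁺ (source<t pq∈P)))

    private
      follow-fixed-target : ∀ {x y} → (x , y) ∈ P → follow P y ≡ y → y < t → x ≡ y
      follow-fixed-target {x} {y} xy∈P y-fixed y<t with continues xy∈P y<t
      ... | r , yr∈P = leftUnique xy∈P
        (subst (λ k → (y , k) ∈ P) (trans (sym (follow-edge rightUnique yr∈P)) y-fixed) yr∈P)

    follow-injectiveOn : InjectiveOn (follow P) (upTo t)
    follow-injectiveOn {x} {y} x∈ y∈ eq with follow-edge-or-fixed P x | follow-edge-or-fixed P y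
    ... | inj₂ x-fixed | inj₂ y-fixed = trans (sym x-fixed) (trans eq y-fixed)
    ... | inj₁ x-edge  | inj₁ y-edge  = leftUnique x-edge (subst (λ k → (y , k) ∈ P) (sym eq) y-edge)
    ... | inj₁ x-edge  | inj₂ y-fixed =
      follow-fixed-target (subst (λ k → (x , k) ∈ P) (trans eq y-fixed) x-edge) y-fixed (∈-upTo⁻ y∈)
    ... | inj₂ x-fixed | inj₁ y-edge  =
      sym (follow-fixed-target (subst (λ k → (y , k) ∈ P) (trans (sym eq) x-fixed) y-edge)
                               x-fixed (∈-upTo⁻ x∈))

    complete-matching : IsMatching G (complete P)
    complete-matching =
      graph-matching G (follow P) (upTo t) (All.tabulate edge) (Unique.upTo⁺ t) follow-injectiveOn
      where
      edge : ∀ {i} → i ∈ upTo t → E i (follow P i)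
      edge {i} i∈ with follow-edge-or-fixed P i
      ... | inj₁ e∈P   = All.lookup edges e∈P
      ... | inj₂ fixed = subst (E i) (sym fixed) (diagonal i (∈-upTo⁻ i∈))

  pathEdges-completable : ∀ ys j →
    All (InE G) (pathEdges G (ys ∷ʳ j)) →
    RightUnique (pathEdges G (ys ∷ʳ j)) → LeftUnique (pathEdges G (ys ∷ʳ j)) →
    All (_< t) ys → (j < t → j ∈ ys) → Completable (pathEdges G (ys ∷ʳ j))
  pathEdges-completable ys j edges ru lu upper j∈ys = record
    { edges       = edges
    ; rightUnique = ru
    ; leftUnique  = lu
    ; source<t    = λ m → All.lookup upper (pathEdges-source∈init G ys j m)
    ; continues   = continues
    }
    where
    continues : ∀ {p q} → (p , q) ∈ pathEdges G (ys ∷ʳ j) → q < t →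
                ∃[ r ] (q , r) ∈ pathEdges G (ys ∷ʳ j)
    continues m q<t with ∈-++⁻ ys (pathEdges-target G (ys ∷ʳ j) m)
    ... | inj₁ q∈ys        = pathEdges-successor G ys j q∈ys
    ... | inj₂ (here refl) = pathEdges-successor G ys j (j∈ys q<t)

module _ (G : BipGraph) (t : ℕ) (diagonal : ∀ i → i < t → BipGraph.E G i i)
         (bounded : ∀ L → IsMatching G L → length L ≤ t) where
  open Completion G t diagonal
  private module Flipped = Completion (flipG G) t diagonal

  length≡t⇒maximum : ∀ {N} → IsMatching G N → length N ≡ t → IsMaximumMatching G N
  length≡t⇒maximum m eq = m , λ N′ m′ → subst (length N′ ≤_) (sym eq) (bounded N′ m′)

  complete-maximum : ∀ {P} → Completable P → IsMaximumMatching G (complete P)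
  complete-maximum {P} c = length≡t⇒maximum (complete-matching c) (length-complete P)

  rightAugmented⇒allowed : ∀ e → InRightAugPath G t e → Allowed G e
  rightAugmented⇒allowed e (is , iℓ , j , (_ , upper , distinct , edges) , t≤j , ℓj∈E , e∈) =
    complete P , complete-maximum c ,
    ∈-complete⁺ c (subst (λ zs → e ∈ pathEdges G zs) (sym (++-assoc is [ iℓ ] [ j ])) e∈)
    where
    P = pathEdges G (is ∷ʳ iℓ ∷ʳ j)
    j∉ : j ∉ is ∷ʳ iℓ
    j∉ j∈ = ≤⇒≯ t≤j (All.lookup upper j∈)
    distinct′ : Unique (is ∷ʳ iℓ ∷ʳ j)
    distinct′ = Unique-∷ʳ⁺ distinct j∉
    c : Completable P
    c = pathEdges-completable (is ∷ʳ iℓ) j (All-pathEdges-∷ʳ G is iℓ j edges ℓj∈E)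
          (pathEdges-rightUnique G _ distinct′) (pathEdges-leftUnique G _ distinct′)
          upper (λ j<t → ⊥-elim (≤⇒≯ t≤j j<t))

  -- In the reversed graph the path is right-augmented.
  leftAugmented⇒allowed : ∀ e → InLeftAugPath G t e → Allowed G e
  leftAugmented⇒allowed e (i₀ , i₁ , rest , (_ , upper , distinct , edges) , t≤i₀ , 01∈E , e∈) =
    map swap (Flipped.complete P) ,
    length≡t⇒maximum (swap-matching G (Flipped.complete-matching c))
                     (trans (length-map swap (Flipped.complete P)) (Flipped.length-complete P)) ,
    ∈-map⁺ swap (Flipped.∈-complete⁺ c (∈-map⁺ swap e∈))
    where
    path = i₀ ∷ i₁ ∷ rest
    P = map swap (pathEdges G path)
    distinct′ : Unique path
    distinct′ = AllP.¬Any⇒All¬ _ (λ i₀∈ → ≤⇒≯ t≤i₀ (All.lookup upper i₀∈)) ∷ distinct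
    unswap : ∀ {p q} → (p , q) ∈ P → (q , p) ∈ pathEdges G path
    unswap m with ∈-map⁻ swap m
    ... | _ , e′∈ , refl = e′∈
    continues : ∀ {p q} → (p , q) ∈ P → q < t → ∃[ r ] (q , r) ∈ P
    continues m q<t with pathEdges-source G path (unswap m)
    ... | here refl = ⊥-elim (≤⇒≯ t≤i₀ q<t)
    ... | there q∈ with pathEdges-predecessor G i₀ (i₁ ∷ rest) q∈
    ...   | r , rq∈ = r , ∈-map⁺ swap rq∈
    c : Flipped.Completable P
    c = record
      { edges       = AllP.map⁺ (01∈E ∷ edges)
      ; rightUnique = λ m m′ → pathEdges-leftUnique G path distinct′ (unswap m) (unswap m′)
      ; leftUnique  = λ m m′ → pathEdges-rightUnique G path distinct′ (unswap m) (unswap m′)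
      ; source<t    = λ m → All.lookup upper (pathEdges-target∈tail G i₀ (i₁ ∷ rest) (unswap m))
      ; continues   = continues
      }

  augmented⇒allowed : ∀ e → InLeftAugPath G t e ⊎ InRightAugPath G t e → Allowed G e
  augmented⇒allowed e = [ leftAugmented⇒allowed e , rightAugmented⇒allowed e ]′

  diagonal-matching : ∀ {cs} → All (_< t) cs → Unique cs → IsMatching G (graph (λ i → i) cs)
  diagonal-matching {cs} upper distinct =
    graph-matching G (λ i → i) cs (All.map (λ {i} → diagonal i) upper) distinct (λ _ _ eq → eq)

  distinct-upper-length≤t : ∀ {cs} → All (_< t) cs → Unique cs → length cs ≤ t
  distinct-upper-length≤t {cs} upper distinct =
    subst (_≤ t) (length-map _ cs) (bounded _ (diagonal-matching upper distinct))

  retarget : List ℕ → Edge → Edge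
  retarget cs (i , j) = i , (if does (j ∈? cs) then i else j)

  -- Bending every L-edge (i , j) into cs to (i , i) and adding (x , x) augments L along cs.
  module _ {L cs x} (matching : IsMatching G L) (upper : All (_< t) cs) (x∈cs : x ∈ cs)
           (x-free : ∀ j → (x , j) ∉ L) (closed : ∀ {i j} → (i , j) ∈ L → j ∈ cs → i ∈ cs) where

    private
      sources = proj₁ (proj₂ matching)
      targets = proj₂ (proj₂ matching)

      edge : ∀ {e} → e ∈ L → InE G (retarget cs e)
      edge {i , j} ij∈L with j ∈? cs
      ... | yes j∈ = diagonal i (All.lookup upper (closed ij∈L j∈))
      ... | no  _  = All.lookup (proj₁ matching) ij∈L

      retarget-injectiveOn : InjectiveOn (proj₂ ∘′ retarget cs) L
      retarget-injectiveOn {i , j} {i′ , j′} m m′ eq with j ∈? cs | j′ ∈? cs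
      ... | yes _  | yes _   = Unique-map⇒injectiveOn proj₁ sources m m′ eq
      ... | no  _  | no  _   = Unique-map⇒injectiveOn proj₂ targets m m′ eq
      ... | yes j∈ | no j′∉ = ⊥-elim (j′∉ (subst (_∈ cs) eq (closed m j∈)))
      ... | no j∉  | yes j′∈ = ⊥-elim (j∉ (subst (_∈ cs) (sym eq) (closed m′ j′∈)))

      x∉sources : x ∉ map proj₁ L
      x∉sources x∈ with ∈-map⁻ proj₁ x∈
      ... | (_ , j) , xj∈L , refl = x-free j xj∈L

      x∉targets : x ∉ map (proj₂ ∘′ retarget cs) L
      x∉targets x∈ with ∈-map⁻ _ x∈
      ... | (i , j) , ij∈L , eq with j ∈? cs
      ...   | yes _ = x-free j (subst (λ k → (k , j) ∈ L) (sym eq) ij∈L)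
      ...   | no j∉ = j∉ (subst (_∈ cs) eq x∈cs)

    augment-matching : IsMatching G ((x , x) ∷ map (retarget cs) L)
    augment-matching =
        diagonal x (All.lookup upper x∈cs) ∷ AllP.map⁺ (All.tabulate edge)
      , subst (λ ys → Unique (x ∷ ys)) (map-∘ L) (AllP.¬Any⇒All¬ _ x∉sources ∷ sources)
      , subst (λ ys → Unique (x ∷ ys)) (map-∘ L)
          (AllP.¬Any⇒All¬ _ x∉targets
             ∷ Unique-map⁺-injectiveOn _ (Unique.map⁻ sources) retarget-injectiveOn)

  module TypeII {L} (maximum : IsMaximumMatching G L) (e₀ : Edge)
    (typeII : ∀ N → IsMaximumMatching G N → e₀ ∈ N → ∃[ f ] (f ∈ N × Lower G t f)) where

    private
      matching = proj₁ maximum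
      L-edge = All.lookup (proj₁ matching)
      L-rightUnique = matching⇒rightUnique G matching
      L-leftUnique  = matching⇒leftUnique G matching

    no-upper-completable : ∀ {P} → Completable P → (∀ {e} → e ∈ P → Upper G t e) → e₀ ∈ P → ⊥
    no-upper-completable {P} c upperP e₀∈
      with typeII (complete P) (complete-maximum c) (∈-complete⁺ c e₀∈)
    ... | f , f∈ , lower with ∈-complete⁻ P f∈
    ...   | inj₁ f∈P             = lower (upperP f∈P)
    ...   | inj₂ (i , i<t , refl) = lower (i<t , i<t)

    no-upper-cycle : ∀ ys j → All (_< t) ys → j ∈ ys → All (_∈ L) (pathEdges G (ys ∷ʳ j)) →
                     e₀ ∈ pathEdges G (ys ∷ʳ j) → ⊥
    no-upper-cycle ys j upper j∈ys inL = no-upper-completable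
      (pathEdges-completable ys j (All.map L-edge inL)
        (λ m m′ → L-rightUnique (All.lookup inL m) (All.lookup inL m′))
        (λ m m′ → L-leftUnique (All.lookup inL m) (All.lookup inL m′))
        upper (λ _ → j∈ys))
      (pathEdges-upper G (ys ∷ʳ j) (AllP.∷ʳ⁺ upper (All.lookup upper j∈ys)))

    record Chain (cs : List ℕ) : Set where
      field
        upper    : All (_< t) cs
        distinct : Unique cs
        alongL   : All (_∈ L) (pathEdges G cs)

    chain⇒upperAltPath : ∀ {cs} → Chain cs → e₀ ∈ pathEdges G cs → UpperAltPath G t cs
    chain⇒upperAltPath {cs} c e₀∈ =
      pathEdges-length G cs e₀∈ , upper , distinct , All.map L-edge alongL
      where open Chain c

    chain-overlong : ∀ {cs} → Chain cs → t < length cs → ⊥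
    chain-overlong c = ≤⇒≯ (distinct-upper-length≤t upper distinct)
      where open Chain c

    chain-∷ : ∀ {i p cs} → Chain (p ∷ cs) → i < t → i ∉ p ∷ cs → (i , p) ∈ L → Chain (i ∷ p ∷ cs)
    chain-∷ c i<t i∉ ip∈L = record
      { upper = i<t ∷ upper ; distinct = AllP.¬Any⇒All¬ _ i∉ ∷ distinct ; alongL = ip∈L ∷ alongL }
      where open Chain c

    chain-∷ʳ : ∀ {cs x j} → Chain (cs ∷ʳ x) → j < t → j ∉ cs ∷ʳ x → (x , j) ∈ L → Chain (cs ∷ʳ x ∷ʳ j)
    chain-∷ʳ {cs} {x} {j} c j<t j∉ xj∈L = record
      { upper = AllP.∷ʳ⁺ upper j<t
      ; distinct = Unique-∷ʳ⁺ distinct j∉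
      ; alongL = All-pathEdges-∷ʳ G cs x j alongL xj∈L
      }
      where open Chain c

    no-augmenting-chain : ∀ p qs x → Chain (p ∷ qs ∷ʳ x) →
                          (∀ i → (i , p) ∉ L) → (∀ j → (x , j) ∉ L) → ⊥
    no-augmenting-chain p qs x c p-free x-free =
      1+n≰n (subst (λ n → suc n ≤ length L) (length-map _ L)
                   (proj₂ maximum _ (augment-matching matching upper x∈ x-free closed)))
      where
      open Chain c
      x∈ : x ∈ p ∷ qs ∷ʳ x
      x∈ = ∈-++⁺ʳ (p ∷ qs) (here refl)
      closed : ∀ {i j} → (i , j) ∈ L → j ∈ p ∷ qs ∷ʳ x → i ∈ p ∷ qs ∷ʳ x
      closed ij∈L (here refl) = ⊥-elim (p-free _ ij∈L)
      closed ij∈L (there j∈) with pathEdges-predecessor G p (qs ∷ʳ x) j∈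
      ... | _ , i′j∈ =
        subst (_∈ _) (L-leftUnique (All.lookup alongL i′j∈) ij∈L) (pathEdges-source G _ i′j∈)

    predecessor-fresh : ∀ p qs x → Chain (p ∷ qs ∷ʳ x) → (∀ j → (x , j) ∉ L) →
                        ∀ {i} → (i , p) ∈ L → i ∉ p ∷ qs ∷ʳ x
    predecessor-fresh p qs x c x-free ip∈L i∈ with ∈-++⁻ (p ∷ qs) i∈
    ... | inj₂ (here refl) = x-free p ip∈L
    ... | inj₁ i∈init with pathEdges-successor G (p ∷ qs) x i∈init
    ...   | _ , is∈ = Unique.Unique[x∷xs]⇒x∉xs distinct
            (subst (_∈ qs ∷ʳ x) (L-rightUnique (All.lookup alongL is∈) ip∈L)
                   (pathEdges-target∈tail G p (qs ∷ʳ x) is∈))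
      where open Chain c

    Result : Set
    Result = InLeftAugPath G t e₀ ⊎ InRightAugPath G t e₀

    -- The fuel only ensures termination: a chain has at most t vertices.
    extendLeft : ∀ fuel p qs x → t ≤ length (p ∷ qs ∷ʳ x) + fuel → Chain (p ∷ qs ∷ʳ x) →
                 (∀ j → (x , j) ∉ L) → e₀ ∈ pathEdges G (p ∷ qs ∷ʳ x) → Result
    extendLeft fuel p qs x bound c x-free e₀∈ with inEdge? L p
    ... | inj₂ p-free = ⊥-elim (no-augmenting-chain p qs x c p-free x-free)
    ... | inj₁ (i , ip∈L) with i <? t
    ...   | no i≮t =
      inj₁ (i , p , qs ∷ʳ x , chain⇒upperAltPath c e₀∈ , ≮⇒≥ i≮t , L-edge ip∈L , there e₀∈)
    ...   | yes i<t = continue fuel bound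
      where
      c′ : Chain (i ∷ p ∷ qs ∷ʳ x)
      c′ = chain-∷ c i<t (predecessor-fresh p qs x c x-free ip∈L) ip∈L
      continue : ∀ fuel → t ≤ length (p ∷ qs ∷ʳ x) + fuel → Result
      continue zero    bound = ⊥-elim (chain-overlong c′ (s≤s (subst (t ≤_) (+-identityʳ _) bound)))
      continue (suc m) bound =
        extendLeft m i (p ∷ qs) x (subst (t ≤_) (+-suc _ m) bound) c′ x-free (there e₀∈)

    extendRight : ∀ fuel p qs x → t ≤ length (p ∷ qs ∷ʳ x) + fuel → Chain (p ∷ qs ∷ʳ x) →
                  e₀ ∈ pathEdges G (p ∷ qs ∷ʳ x) → Result
    extendRight fuel p qs x bound c e₀∈ with outEdge? L x
    ... | inj₂ x-free = extendLeft t p qs x (m≤n+m t _) c x-free e₀∈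
    ... | inj₁ (j , xj∈L) with j <? t
    ...   | no j≮t = inj₂ (p ∷ qs , x , j , chain⇒upperAltPath c e₀∈ , ≮⇒≥ j≮t , L-edge xj∈L ,
                           subst (λ zs → e₀ ∈ pathEdges G zs) (++-assoc (p ∷ qs) [ x ] [ j ])
                                 (pathEdges-∷ʳ⁺ G (p ∷ qs) x j e₀∈))
    ...   | yes j<t with j ∈? (p ∷ qs ∷ʳ x)
    ...     | yes j∈ = ⊥-elim (no-upper-cycle (p ∷ qs ∷ʳ x) j (Chain.upper c) j∈
                         (All-pathEdges-∷ʳ G (p ∷ qs) x j (Chain.alongL c) xj∈L)
                         (pathEdges-∷ʳ⁺ G (p ∷ qs) x j e₀∈))
    ...     | no j∉ = continue fuel bound
      where
      c′ : Chain (p ∷ qs ∷ʳ x ∷ʳ j)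
      c′ = chain-∷ʳ {p ∷ qs} c j<t j∉ xj∈L
      grown : length (p ∷ qs ∷ʳ x ∷ʳ j) ≡ suc (length (p ∷ qs ∷ʳ x))
      grown = length-∷ʳ (p ∷ qs ∷ʳ x) j
      continue : ∀ fuel → t ≤ length (p ∷ qs ∷ʳ x) + fuel → Result
      continue zero    bound =
        ⊥-elim (chain-overlong c′ (subst (t <_) (sym grown) (s≤s (subst (t ≤_) (+-identityʳ _) bound))))
      continue (suc m) bound =
        extendRight m p (qs ∷ʳ x) j (subst (t ≤_) (trans (+-suc _ m) (cong (_+ m) (sym grown))) bound)
                    c′ (pathEdges-∷ʳ⁺ G (p ∷ qs) x j e₀∈)

  typeII⇒augmented : ∀ e → AllowedTypeII G t e → InLeftAugPath G t e ⊎ InRightAugPath G t e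
  typeII⇒augmented (a , b) ((a<t , b<t) , (L , maximum , ab∈L) , typeII) with a ≟ b
  ... | yes refl = ⊥-elim (no-upper-cycle [ a ] a (a<t ∷ []) (here refl) (ab∈L ∷ []) (here refl))
    where open TypeII maximum (a , a) typeII
  ... | no a≢b = extendRight t a [] b (m≤n+m t 2) chain (here refl)
    where
    open TypeII maximum (a , b) typeII
    chain : Chain (a ∷ b ∷ [])
    chain = record { upper = a<t ∷ b<t ∷ [] ; distinct = (a≢b ∷ []) ∷ [] ∷ [] ; alongL = ab∈L ∷ [] }

theorem8 : (G : BipGraph) (t : ℕ) →
    BipGraph.n₁ G ≤ BipGraph.n₂ G → t ≤ BipGraph.n₁ G →
    (∀ i → i < t → BipGraph.E G i i) →
    (∀ L → IsMatching G L → length L ≤ t) →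
    (∀ e → AllowedTypeII G t e → InLeftAugPath G t e ⊎ InRightAugPath G t e)
    × (∀ e → InLeftAugPath G t e ⊎ InRightAugPath G t e → Allowed G e)
theorem8 G t _ _ diagonal bounded =
  typeII⇒augmented G t diagonal bounded , augmented⇒allowed G t diagonal bounded
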